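{- Let $p\ge 4$ be an integer with $p=kd$ for some positive integers $k,d$ with $1<k,d<p$. Then $\bar d(K(p,p,q))=2$ whenever $$2k+2\le q\le \max_{d'}\{\Phi^*(p,d')\}+2,$$ where the maximum is taken over all positive divisors $d'$ of $p$ with $1<d'<p$.
   Context: $K(p,p,q)$ is the complete tripartite graph with partite sets of sizes $p,p,q$. The orientation number $\bar d(G)$ of a connected bridgeless graph $G$ is the minimum of the diameter $d(D)$ over all strong orientations $D$ of $G$, where $d(D)$ is the maximum over ordered pairs of vertices of the length of a shortest directed path. For a divisor $d'$ of $p$ with $1<d'<p$ and $k'=p/d'$, $\Phi^*(p,d')=\sum \binom{k'}{x_1}\binom{k'}{x_2}\cdots\binom{k'}{x_{2d'}}$, the sum taken over all integer tuples $(x_1,\ldots,x_{2d'})$ with $x_1+\cdots+x_{2d'}=p$ and $1\le x_r\le k'-1$ for all $r$. -}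

module Defs where

open import Data.Nat using (ℕ; zero; suc; _+_; _*_; _∸_; _≤_; _<_; _≤ᵇ_; _⊔_; NonZero)
open import Data.Nat.DivMod using (_/_)
open import Data.Nat.Divisibility using (_∣?_)
open import Data.Nat.Combinatorics using (_C_)
open import Data.Bool using (Bool; true; false; if_then_else_)
open import Data.List using (List; map; foldr; applyUpTo; upTo)
open import Data.Nat.ListAction using (sum)
open import Data.Fin using (Fin)
open import Data.Sum using (_⊎_; inj₁; inj₂)
open import Data.Product using (Σ; ∃; _×_; _,_)
open import Data.Empty using (⊥)
open import Relation.Nullary using (¬_; does)
open import Relation.Binary.PropositionalEquality using (_≡_)

record Graph : Set₁ where
  field
    V     : Set
    Adj   : V → V → Set
    sym   : ∀ {u v} → Adj u v → Adj v u
    irref : ∀ {u} → ¬ Adj u u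

open Graph public

record Orientation (G : Graph) : Set₁ where
  field
    Arc      : V G → V G → Set
    arc-edge : ∀ {u v} → Arc u v → Adj G u v
    covers   : ∀ {u v} → Adj G u v → Arc u v ⊎ Arc v u
    antisym  : ∀ {u v} → Arc u v → Arc v u → ⊥

open Orientation public

data Walk {G : Graph} (D : Orientation G) : ℕ → V G → V G → Set where
  here : ∀ {u} → Walk D zero u u
  step : ∀ {n u w v} → Arc D u w → Walk D n w v → Walk D (suc n) u v

Dist : {G : Graph} (D : Orientation G) → V G → V G → ℕ → Set
Dist D u v n = Walk D n u v × (∀ m → m < n → ¬ Walk D m u v)

Strong : {G : Graph} → Orientation G → Set
Strong {G} D = ∀ (u v : V G) → ∃ λ n → Walk D n u v

HasDiameter : {G : Graph} → Orientation G → ℕ → Set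
HasDiameter {G} D m =
  (∀ (u v : V G) → ∃ λ n → Dist D u v n × n ≤ m)
  × (Σ (V G) λ u → Σ (V G) λ v → Dist D u v m)

OrientationNumber : Graph → ℕ → Set₁
OrientationNumber G m =
  (Σ (Orientation G) λ D → Strong D × HasDiameter D m)
  × (∀ (D : Orientation G) → Strong D → ∀ m' → HasDiameter D m' → m ≤ m')

KV : ℕ → ℕ → Set
KV p q = Fin p ⊎ (Fin p ⊎ Fin q)

part : ∀ {p q} → KV p q → Fin 3
part (inj₁ _)        = Fin.zero
part (inj₂ (inj₁ _)) = Fin.suc Fin.zero
part (inj₂ (inj₂ _)) = Fin.suc (Fin.suc Fin.zero)

K-sym : ∀ {p q} {u v : KV p q} → ¬ (part u ≡ part v) → ¬ (part v ≡ part u)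
K-sym h e = h (Relation.Binary.PropositionalEquality.sym e)

K : ℕ → ℕ → Graph
K p q = record
  { V     = KV p q
  ; Adj   = λ u v → ¬ (part u ≡ part v)
  ; sym   = K-sym
  ; irref = λ h → h Relation.Binary.PropositionalEquality.refl
  }

Kppq : ℕ → ℕ → Graph
Kppq p q = K p q

-- F k' m s = Σ over (x₁,…,x_m) with x₁+…+x_m = s, 1 ≤ xᵣ ≤ k'-1,
--            of  C(k',x₁)⋯C(k',x_m).
F : ℕ → ℕ → ℕ → ℕ
F k' zero    zero    = 1
F k' zero    (suc s) = 0
F k' (suc m) s =
  sum (map (λ x → if x ≤ᵇ s then (k' C x) * F k' m (s ∸ x) else 0)
           (applyUpTo suc (k' ∸ 1)))

PhiStar : (p d' : ℕ) → .{{NonZero d'}} → ℕ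
PhiStar p d' = F (p / d') (2 * d') p

-- max { Φ*(p,d') : d' ∣ p, 1 < d' < p }   (d' = 2 + i, i < p - 2)
maxPhiStar : ℕ → ℕ
maxPhiStar p =
  foldr _⊔_ 0
    (map (λ i → if does ((2 + i) ∣? p) then PhiStar p (2 + i) else 0)
         (upTo (p ∸ 2)))

module Submission where

-- Two vertices of the same part are non-adjacent, so no orientation has diameter below 2.
-- For the upper bound write p = D k with D, k ≥ 2 and cut each p-part A, B into D blocks of
-- k points; orient A → B between different blocks and B → A inside a block. In the q-part,
-- one vertex is entered from all of A and leads to all of B, another does the reverse, and
-- every other vertex leads to a nonempty proper subset of each block of A and of B, these
-- subsets having total size p, so that two distinct such patterns are separated by a point.
-- Using distinct patterns, among them for each position i the one that omits i from every
-- block of A and is {i} on every block of B, every ordered pair of vertices is joined by a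
-- directed path of length at most 2. The patterns are counted by Φ*(p, D), so the
-- construction works when k ≤ q − 2 ≤ Φ*(p, D): with the given factorisation if
-- q − 2 ≤ Φ*(p, d), and otherwise q − 2 > Φ*(p, d) ≥ p ≥ p / d' for a maximising divisor d'.

open import Defs hiding (sym)
open import Data.Nat using (ℕ; zero; suc; _+_; _*_; _∸_; _≤_; _<_; _⊔_; _≤ᵇ_; _≤?_; z≤n; s≤s; s≤s⁻¹)
open import Data.Nat.Properties hiding (_≟_)
open import Data.Nat.Combinatorics using (_C_; nCk+nC[k+1]≡[n+1]C[k+1])
open import Data.Nat.DivMod using (_/_; m*[n/m]≡n)
open import Data.Nat.Divisibility using (_∣?_)
open import Data.Nat.ListAction using (sum)
open import Data.Bool using (true; false; if_then_else_)
open import Data.Bool.Properties as Bool using (T-≡)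
open import Data.Fin as Fin using (Fin; _↑ˡ_; _↑ʳ_; quotient; remainder; combine)
  renaming (zero to fzero; suc to fsuc)
open import Data.Fin.Properties
  using (_≟_; any?; all?; ¬∀⟶∃¬; injective⇒≤; splitAt⁻¹-↑ˡ; splitAt⁻¹-↑ʳ; remQuot-combine; combine-remQuot)
open import Data.Fin.Subset using (Subset; inside; outside; ∣_∣; _∈_; _∉_; Nonempty; ∁; ⁅_⁆)
  renaming (⊥ to ∅; ⊤ to full)
open import Data.Fin.Subset.Properties
  using ( ∣⊥∣≡0; ∣∁p∣≡n∸∣p∣; nonempty?; Empty-unique; ∣⁅x⁆∣≡1; x∈⁅x⁆; x∈⁅y⁆⇒x≡y; x≢y⇒x∉⁅y⁆
        ; x∈p⇒x∉∁p; x∉p⇒x∈∁p; x∈∁p⇒x∉p; ∉⊥; ∈⊤; _∈?_)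
open import Data.List
  using (List; []; _∷_; [_]; map; _++_; foldr; concatMap; applyUpTo; upTo; length; lookup; cartesianProductWith)
open import Data.List.Properties using (length-++; length-map; map-cong)
open import Data.List.Membership.Propositional using (find; lose) renaming (_∈_ to _∈ˡ_)
open import Data.List.Membership.Propositional.Properties
  using ( ∈-++⁻; ∈-++⁺ˡ; ∈-++⁺ʳ; ∈-map⁺; ∈-map⁻; ∈-concatMap⁺; ∈-concatMap⁻; ∈-applyUpTo⁺; ∈-applyUpTo⁻
        ; ∈-cartesianProductWith⁺; ∈-cartesianProductWith⁻; ∈-lookup; ∈-upTo⁻)
open import Data.List.Relation.Unary.Any as Any using (here; there)
open import Data.List.Relation.Unary.Any.Properties using (lookup-index)
open import Data.List.Relation.Unary.All as ListAll using ([]; _∷_)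
open import Data.List.Relation.Unary.AllPairs using ([]; _∷_)
open import Data.List.Relation.Unary.Unique.Propositional using (Unique)
import Data.List.Relation.Unary.Unique.Propositional.Properties as Unique
open import Data.Vec as Vec using (Vec; []; _∷_; here; there)
open import Data.Vec.Properties
  using ( ∷-injective; ∷-injectiveʳ; ≡-dec; lookup-++ˡ; lookup-++ʳ; lookup∘tabulate; map-++; sum-++
        ; lookup⇒[]=; []=⇒lookup)
open import Data.Vec.Relation.Unary.All using (All; []; _∷_)
open import Data.Vec.Relation.Unary.All.Properties using (++⁺; tabulate⁺; lookup⁺)
import Data.Vec.Functional as Vector
open import Data.Product using (Σ; ∃; ∃₂; _×_; _,_; proj₁; proj₂)
open import Data.Sum using (_⊎_; inj₁; inj₂)
import Data.Sum.Properties as Sum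
open import Data.Empty using (⊥; ⊥-elim)
open import Function using (_∘_; Equivalence; Injective)
open import Relation.Nullary using (¬_; Dec; yes; no; ¬?; does)
open import Relation.Binary.Definitions using (DecidableEquality)
open import Relation.Binary.PropositionalEquality hiding ([_])

length-cartesianProductWith : ∀ {A B C : Set} (f : A → B → C) xs ys →
  length (cartesianProductWith f xs ys) ≡ length xs * length ys
length-cartesianProductWith f []       ys = refl
length-cartesianProductWith f (x ∷ xs) ys = begin
  length (map (f x) ys ++ cartesianProductWith f xs ys)
    ≡⟨ length-++ (map (f x) ys) ⟩
  length (map (f x) ys) + length (cartesianProductWith f xs ys)
    ≡⟨ cong₂ _+_ (length-map (f x) ys) (length-cartesianProductWith f xs ys) ⟩
  length ys + length xs * length ys ∎
  where open ≡-Reasoning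

length-concatMap : ∀ {A B : Set} (f : A → List B) xs →
  length (concatMap f xs) ≡ sum (map (length ∘ f) xs)
length-concatMap f []       = refl
length-concatMap f (x ∷ xs) = trans (length-++ (f x)) (cong (length (f x) +_) (length-concatMap f xs))

Unique-concatMap : ∀ {A B : Set} (f : A → List B) {xs} → Unique xs →
  (∀ x → Unique (f x)) → (∀ {x y b} → b ∈ˡ f x → b ∈ˡ f y → x ≡ y) →
  Unique (concatMap f xs)
Unique-concatMap f {[]}     []           _   _    = []
Unique-concatMap f {x ∷ xs} (x∉xs ∷ uxs) ufx from =
  Unique.++⁺ (ufx x) (Unique-concatMap f uxs ufx from) disjoint
  where
  disjoint : ∀ {b} → ¬ (b ∈ˡ f x × b ∈ˡ concatMap f xs)
  disjoint (b∈fx , b∈rest) with find (∈-concatMap⁻ f {xs = xs} b∈rest)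
  ... | y , y∈xs , b∈fy = ListAll.lookup x∉xs y∈xs (from b∈fx b∈fy)

Unique⇒lookup-injective : ∀ {A : Set} {xs : List A} → Unique xs → Injective _≡_ _≡_ (lookup xs)
Unique⇒lookup-injective (_    ∷ _)      {fzero}  {fzero}  _ = refl
Unique⇒lookup-injective (x∉xs ∷ _)      {fzero}  {fsuc j} e = ⊥-elim (ListAll.lookup x∉xs (∈-lookup j) e)
Unique⇒lookup-injective (x∉xs ∷ _)      {fsuc i} {fzero}  e = ⊥-elim (ListAll.lookup x∉xs (∈-lookup i) (sym e))
Unique⇒lookup-injective (_    ∷ unique) {fsuc i} {fsuc j} e = cong fsuc (Unique⇒lookup-injective unique e)

index-injective : ∀ {A : Set} {n} {xs : List A} (f : Fin n → A) (f∈ : ∀ i → f i ∈ˡ xs) →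
  Injective _≡_ _≡_ f → Injective _≡_ _≡_ (Any.index ∘ f∈)
index-injective {xs = xs} f f∈ f-inj {i} {j} e =
  f-inj (trans (lookup-index (f∈ i)) (trans (cong (lookup xs) e) (sym (lookup-index (f∈ j)))))

injection-into-list⇒≤ : ∀ {A : Set} {n} {xs : List A} (f : Fin n → A) →
  Injective _≡_ _≡_ f → (∀ i → f i ∈ˡ xs) → n ≤ length xs
injection-into-list⇒≤ f f-inj f∈ = injective⇒≤ (index-injective f f∈ f-inj)

-- If π missed no value, choosing a preimage of each value would inject Fin N into Fin h.
missedValue : ∀ {h N} → h < N → (π : Fin h → Fin N) → Injective _≡_ _≡_ π → ∃ λ v → ∀ j → π j ≢ v
missedValue {h} {N} h<N π π-inj with any? (λ v → all? (λ j → ¬? (π j ≟ v)))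
... | yes missed = missed
... | no  ¬missed = ⊥-elim (<⇒≱ h<N (injective⇒≤ preimage-injective))
  where
  hit : ∀ v → ∃ λ j → π j ≡ v
  hit v with ¬∀⟶∃¬ h (λ j → π j ≢ v) (λ j → ¬? (π j ≟ v)) (λ ∀≢ → ¬missed (v , ∀≢))
  ... | j , ¬≢ with π j ≟ v
  ...   | yes πj≡v = j , πj≡v
  ...   | no  πj≢v = ⊥-elim (¬≢ πj≢v)
  preimage-injective : Injective _≡_ _≡_ (proj₁ ∘ hit)
  preimage-injective {v} {w} e = trans (sym (proj₂ (hit v))) (trans (cong π e) (proj₂ (hit w)))

extendInjection : ∀ n {h m N} → n + h ≡ m → m ≤ N → (π : Fin h → Fin N) → Injective _≡_ _≡_ π →
  Σ (Fin m → Fin N) λ σ → Injective _≡_ _≡_ σ × (∀ j → ∃ λ i → σ i ≡ π j)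
extendInjection zero    refl _   π π-inj = π , π-inj , λ j → j , refl
extendInjection (suc n) {h} refl m≤N π π-inj
  with missedValue (≤-trans (s≤s (m≤n+m h n)) m≤N) π π-inj
... | v , π≢v with extendInjection n (+-suc n h) m≤N (v Vector.∷ π) v∷π-injective
  where
  v∷π-injective : Injective _≡_ _≡_ (v Vector.∷ π)
  v∷π-injective {fzero}  {fzero}  _ = refl
  v∷π-injective {fzero}  {fsuc j} e = ⊥-elim (π≢v j (sym e))
  v∷π-injective {fsuc i} {fzero}  e = ⊥-elim (π≢v i e)
  v∷π-injective {fsuc i} {fsuc j} e = cong fsuc (π-inj e)
...   | σ , σ-inj , σ-covers = σ , σ-inj , σ-covers ∘ fsuc

injectiveFamilyExtending : ∀ {A : Set} {xs : List A} {h m} → Unique xs → h ≤ m → m ≤ length xs →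
  (f : Fin h → A) → Injective _≡_ _≡_ f → (∀ i → f i ∈ˡ xs) →
  Σ (Fin m → A) λ g → Injective _≡_ _≡_ g × (∀ z → g z ∈ˡ xs) × (∀ i → ∃ λ z → g z ≡ f i)
injectiveFamilyExtending {xs = xs} {h} {m} unique h≤m m≤len f f-inj f∈
  with extendInjection (m ∸ h) (m∸n+n≡m h≤m) m≤len (Any.index ∘ f∈) (index-injective f f∈ f-inj)
... | σ , σ-inj , σ-covers =
  lookup xs ∘ σ ,
  σ-inj ∘ Unique⇒lookup-injective unique ,
  ∈-lookup ∘ σ ,
  λ i → let z , σz≡ = σ-covers i in z , trans (cong (lookup xs) σz≡) (sym (lookup-index (f∈ i)))

-- Enumerating tuples of subsets

subsetsOfSize : (n x : ℕ) → List (Subset n)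
subsetsOfSize n       zero    = [ ∅ ]
subsetsOfSize zero    (suc x) = []
subsetsOfSize (suc n) (suc x) =
  map (inside ∷_) (subsetsOfSize n x) ++ map (outside ∷_) (subsetsOfSize n (suc x))

length-subsetsOfSize : ∀ n x → length (subsetsOfSize n x) ≡ n C x
length-subsetsOfSize n       zero    = refl
length-subsetsOfSize zero    (suc x) = refl
length-subsetsOfSize (suc n) (suc x) = begin
  length (map (inside ∷_) (subsetsOfSize n x) ++ map (outside ∷_) (subsetsOfSize n (suc x)))
    ≡⟨ length-++ (map (inside ∷_) (subsetsOfSize n x)) ⟩
  length (map (inside ∷_) (subsetsOfSize n x)) + length (map (outside ∷_) (subsetsOfSize n (suc x)))
    ≡⟨ cong₂ _+_ (trans (length-map _ (subsetsOfSize n x)) (length-subsetsOfSize n x))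
                 (trans (length-map _ (subsetsOfSize n (suc x))) (length-subsetsOfSize n (suc x))) ⟩
  n C x + n C suc x
    ≡⟨ nCk+nC[k+1]≡[n+1]C[k+1] n x ⟩
  suc n C suc x ∎
  where open ≡-Reasoning

∈-subsetsOfSize⁻ : ∀ n x {s} → s ∈ˡ subsetsOfSize n x → ∣ s ∣ ≡ x
∈-subsetsOfSize⁻ n       zero    (here refl) = ∣⊥∣≡0 n
∈-subsetsOfSize⁻ (suc n) (suc x) s∈ with ∈-++⁻ (map (inside ∷_) (subsetsOfSize n x)) s∈
... | inj₁ s∈ˡ with ∈-map⁻ (inside ∷_) s∈ˡ
...   | s , s∈ , refl = cong suc (∈-subsetsOfSize⁻ n x s∈)
∈-subsetsOfSize⁻ (suc n) (suc x) s∈ | inj₂ s∈ʳ with ∈-map⁻ (outside ∷_) s∈ʳ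
...   | s , s∈ , refl = ∈-subsetsOfSize⁻ n (suc x) s∈

∈-subsetsOfSize⁺ : ∀ {n} (s : Subset n) → s ∈ˡ subsetsOfSize n ∣ s ∣
∈-subsetsOfSize⁺ []            = here refl
∈-subsetsOfSize⁺ (inside ∷ s)  = ∈-++⁺ˡ (∈-map⁺ (inside ∷_) (∈-subsetsOfSize⁺ s))
∈-subsetsOfSize⁺ (outside ∷ s) with ∣ s ∣ | ∈-subsetsOfSize⁺ s
... | zero  | here refl = here refl
... | suc x | s∈        = ∈-++⁺ʳ (map (inside ∷_) _) (∈-map⁺ (outside ∷_) s∈)

subsetsOfSize-unique : ∀ n x → Unique (subsetsOfSize n x)
subsetsOfSize-unique n       zero    = [] ∷ []
subsetsOfSize-unique zero    (suc x) = []
subsetsOfSize-unique (suc n) (suc x) =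
  Unique.++⁺ (Unique.map⁺ ∷-injectiveʳ (subsetsOfSize-unique n x))
             (Unique.map⁺ ∷-injectiveʳ (subsetsOfSize-unique n (suc x))) disjoint
  where
  disjoint : ∀ {s} → ¬ (s ∈ˡ map (inside ∷_) (subsetsOfSize n x) × s ∈ˡ map (outside ∷_) _)
  disjoint (s∈ˡ , s∈ʳ) with ∈-map⁻ (inside ∷_) s∈ˡ | ∈-map⁻ (outside ∷_) s∈ʳ
  ... | _ , _ , refl | _ , _ , ()

Proper : ∀ {k} → Subset k → Set
Proper {k} s = 1 ≤ ∣ s ∣ × ∣ s ∣ ≤ k ∸ 1

size : ∀ {k m} → Vec (Subset k) m → ℕ
size t = Vec.sum (Vec.map ∣_∣ t)

mutual
  properTuples : (k m s : ℕ) → List (Vec (Subset k) m)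
  properTuples k zero    zero    = [ [] ]
  properTuples k zero    (suc s) = []
  properTuples k (suc m) s       = concatMap (properTuplesWithHead k m s) (applyUpTo suc (k ∸ 1))

  properTuplesWithHead : (k m s x : ℕ) → List (Vec (Subset k) (suc m))
  properTuplesWithHead k m s x =
    if x ≤ᵇ s then cartesianProductWith _∷_ (subsetsOfSize k x) (properTuples k m (s ∸ x)) else []

-- The enumeration mirrors the recursion defining F, term by term.
length-properTuples : ∀ k m s → length (properTuples k m s) ≡ F k m s
length-properTuples k zero    zero    = refl
length-properTuples k zero    (suc s) = refl
length-properTuples k (suc m) s =
  trans (length-concatMap (properTuplesWithHead k m s) (applyUpTo suc (k ∸ 1)))
        (cong sum (map-cong length-withHead (applyUpTo suc (k ∸ 1))))
  where
  length-withHead : ∀ x → length (properTuplesWithHead k m s x)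
                        ≡ (if x ≤ᵇ s then (k C x) * F k m (s ∸ x) else 0)
  length-withHead x with x ≤ᵇ s
  ... | false = refl
  ... | true  = trans (length-cartesianProductWith _∷_ (subsetsOfSize k x) _)
                      (cong₂ _*_ (length-subsetsOfSize k x) (length-properTuples k m (s ∸ x)))

∈-properTuples⁻ : ∀ k m s {t} → t ∈ˡ properTuples k m s → All Proper t × size t ≡ s
∈-properTuples⁻ k zero    zero    (here refl) = [] , refl
∈-properTuples⁻ k (suc m) s       t∈
  with find (∈-concatMap⁻ (properTuplesWithHead k m s) {xs = applyUpTo suc (k ∸ 1)} t∈)
... | x , x∈ , t∈withHead with ∈-applyUpTo⁻ suc x∈ | x ≤ᵇ s in x≤ᵇs
...   | i , i<k-1 , refl | true
  with ∈-cartesianProductWith⁻ _∷_ (subsetsOfSize k x) (properTuples k m (s ∸ x)) t∈withHead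
...     | r , t , r∈ , t∈ , refl with ∈-properTuples⁻ k m (s ∸ x) t∈
...       | proper , size-t =
  subst (λ n → 1 ≤ n × n ≤ k ∸ 1) (sym ∣r∣≡x) (s≤s z≤n , i<k-1) ∷ proper ,
  (begin
    ∣ r ∣ + size t   ≡⟨ cong₂ _+_ ∣r∣≡x size-t ⟩
    x + (s ∸ x)      ≡⟨ m+[n∸m]≡n (≤ᵇ⇒≤ x s (Equivalence.from T-≡ x≤ᵇs)) ⟩
    s                ∎)
  where
  open ≡-Reasoning
  ∣r∣≡x : ∣ r ∣ ≡ x
  ∣r∣≡x = ∈-subsetsOfSize⁻ k x r∈

∈-properTuples⁺ : ∀ {k m} {t : Vec (Subset k) m} → All Proper t → t ∈ˡ properTuples k m (size t)
∈-properTuples⁺ []                               = here refl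
∈-properTuples⁺ {k} {suc m} {r ∷ t} ((1≤∣r∣ , ∣r∣≤k-1) ∷ proper) =
  ∈-concatMap⁺ (properTuplesWithHead k m (∣ r ∣ + size t)) (lose ∣r∣∈ withHead)
  where
  ∈-1…n : ∀ {x n} → 1 ≤ x → x ≤ n → x ∈ˡ applyUpTo suc n
  ∈-1…n {suc i} _ i<n = ∈-applyUpTo⁺ suc i<n
  ∣r∣∈ : ∣ r ∣ ∈ˡ applyUpTo suc (k ∸ 1)
  ∣r∣∈ = ∈-1…n 1≤∣r∣ ∣r∣≤k-1
  withHead : r ∷ t ∈ˡ properTuplesWithHead k m (∣ r ∣ + size t) ∣ r ∣
  withHead rewrite Equivalence.to T-≡ (≤⇒≤ᵇ (m≤m+n ∣ r ∣ (size t))) | m+n∸m≡n ∣ r ∣ (size t) =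
    ∈-cartesianProductWith⁺ _∷_ (∈-subsetsOfSize⁺ r) (∈-properTuples⁺ proper)

properTuples-unique : ∀ k m s → Unique (properTuples k m s)
properTuples-unique k zero    zero    = [] ∷ []
properTuples-unique k zero    (suc s) = []
properTuples-unique k (suc m) s =
  Unique-concatMap (properTuplesWithHead k m s)
    (Unique.applyUpTo⁺₁ suc (k ∸ 1) (λ i<j _ → <⇒≢ i<j ∘ suc-injective))
    withHead-unique
    (λ {x} {y} t∈x t∈y → trans (sym (head-size x t∈x)) (head-size y t∈y))
  where
  withHead-unique : ∀ x → Unique (properTuplesWithHead k m s x)
  withHead-unique x with x ≤ᵇ s
  ... | false = []
  ... | true  = Unique.cartesianProductWith⁺ _∷_ ∷-injective
                  (subsetsOfSize-unique k x) (properTuples-unique k m (s ∸ x))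
  head-size : ∀ x {t} → t ∈ˡ properTuplesWithHead k m s x → ∣ Vec.head t ∣ ≡ x
  head-size x t∈ with x ≤ᵇ s
  ... | true with ∈-cartesianProductWith⁻ _∷_ (subsetsOfSize k x) _ t∈
  ...   | r , _ , r∈ , _ , refl = ∈-subsetsOfSize⁻ k x r∈

∈∉-there : ∀ {n x y} {s s' : Subset n} → (∃ λ i → i ∈ s × i ∉ s') → ∃ λ i → i ∈ x ∷ s × i ∉ y ∷ s'
∈∉-there (i , i∈s , i∉s') = fsuc i , there i∈s , λ { (there i∈s') → i∉s' i∈s' }

separatingElement : ∀ {n} {s s' : Subset n} → ∣ s' ∣ ≤ ∣ s ∣ → s ≢ s' → ∃ λ i → i ∈ s × i ∉ s'
separatingElement {s = []}          {[]}           _  s≢s' = ⊥-elim (s≢s' refl)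
separatingElement {s = inside ∷ s}  {outside ∷ s'} _  _    = fzero , here , λ ()
separatingElement {s = inside ∷ s}  {inside ∷ s'}  le s≢s' =
  ∈∉-there (separatingElement (s≤s⁻¹ le) (s≢s' ∘ cong (inside ∷_)))
separatingElement {s = outside ∷ s} {outside ∷ s'} le s≢s' =
  ∈∉-there (separatingElement le (s≢s' ∘ cong (outside ∷_)))
separatingElement {s = outside ∷ s} {inside ∷ s'}  le _    =
  ∈∉-there (separatingElement (≤-trans (n≤1+n _) le)
                              (λ s≡s' → 1+n≰n (subst (suc ∣ s' ∣ ≤_) (cong ∣_∣ s≡s') le)))

separatingRow : ∀ {k m} {t t' : Vec (Subset k) m} → size t' ≤ size t → t ≢ t' →
  ∃₂ λ j i → i ∈ Vec.lookup t j × i ∉ Vec.lookup t' j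
separatingRow {t = []}    {[]}      _  t≢t' = ⊥-elim (t≢t' refl)
separatingRow {t = v ∷ t} {w ∷ t'} le t≢t' with ∣ w ∣ ≤? ∣ v ∣
... | yes ∣w∣≤∣v∣ with ≡-dec Bool._≟_ v w
...   | no  v≢w  = fzero , separatingElement ∣w∣≤∣v∣ v≢w
...   | yes refl with separatingRow {t = t} {t'} (+-cancelˡ-≤ ∣ v ∣ _ _ le) (t≢t' ∘ cong (v ∷_))
...     | j , sep = fsuc j , sep
separatingRow {t = v ∷ t} {w ∷ t'} le t≢t' | no ∣w∣≰∣v∣
  with separatingRow {t = t} {t'} (<⇒≤ tail<) (λ t≡t' → <⇒≢ tail< (cong size (sym t≡t')))
  where
  tail< : size t' < size t
  tail< = ≰⇒> λ st≤st' → <⇒≱ (+-mono-<-≤ (≰⇒> ∣w∣≰∣v∣) st≤st') le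
... | j , sep = fsuc j , sep

1≤∣s∣⇒Nonempty : ∀ {n} {s : Subset n} → 1 ≤ ∣ s ∣ → Nonempty s
1≤∣s∣⇒Nonempty {n} {s} 1≤∣s∣ with nonempty? s
... | yes nonempty = nonempty
... | no  empty    = ⊥-elim (1+n≰n (subst (1 ≤_) (trans (cong ∣_∣ (Empty-unique empty)) (∣⊥∣≡0 n)) 1≤∣s∣))

Proper⇒Nonempty : ∀ {k} {s : Subset k} → Proper s → Nonempty s
Proper⇒Nonempty (1≤∣s∣ , _) = 1≤∣s∣⇒Nonempty 1≤∣s∣

Proper⇒Nonempty∁ : ∀ {k} {s : Subset k} → Proper s → Nonempty (∁ s)
Proper⇒Nonempty∁ {zero}  (1≤∣s∣ , ∣s∣≤0) = ⊥-elim (1+n≰n (≤-trans 1≤∣s∣ ∣s∣≤0))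
Proper⇒Nonempty∁ {suc k} {s} (_ , ∣s∣≤k) =
  1≤∣s∣⇒Nonempty (subst (1 ≤_) (sym (∣∁p∣≡n∸∣p∣ s)) (m<n⇒0<n∸m (s≤s ∣s∣≤k)))

rowA rowB : ∀ {D k} → Vec (Subset k) (2 * D) → Fin D → Subset k
rowA {D} t r = Vec.lookup t (r ↑ˡ (D + 0))
rowB {D} t r = Vec.lookup t (D ↑ʳ (r ↑ˡ 0))

rowIndex-cases : ∀ D (j : Fin (2 * D)) → (∃ λ r → r ↑ˡ (D + 0) ≡ j) ⊎ (∃ λ r → D ↑ʳ (r ↑ˡ 0) ≡ j)
rowIndex-cases D j with Fin.splitAt D j in eq
... | inj₁ r = inj₁ (r , splitAt⁻¹-↑ˡ eq)
... | inj₂ j' with Fin.splitAt D {0} j' in eq'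
...   | inj₁ r = inj₂ (r , trans (cong (D ↑ʳ_) (splitAt⁻¹-↑ˡ eq')) (splitAt⁻¹-↑ʳ eq))

marked : ∀ {D k} → (Fin D → Fin k) → (Fin D → Fin k) → Vec (Subset k) (2 * D)
marked f g = Vec.tabulate (λ r → ∁ ⁅ f r ⁆) Vec.++ (Vec.tabulate (λ r → ⁅ g r ⁆) Vec.++ [])

rowA-marked : ∀ {D k} (f g : Fin D → Fin k) r → rowA (marked f g) r ≡ ∁ ⁅ f r ⁆
rowA-marked f g r = trans (lookup-++ˡ (Vec.tabulate _) _ r) (lookup∘tabulate _ r)

rowB-marked : ∀ {D k} (f g : Fin D → Fin k) r → rowB (marked f g) r ≡ ⁅ g r ⁆
rowB-marked {D} f g r =
  trans (lookup-++ʳ (Vec.tabulate (λ r → ∁ ⁅ f r ⁆)) _ (r ↑ˡ 0))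
        (trans (lookup-++ˡ (Vec.tabulate _) [] r) (lookup∘tabulate _ r))

size-++ : ∀ {k m n} (t : Vec (Subset k) m) (t' : Vec (Subset k) n) → size (t Vec.++ t') ≡ size t + size t'
size-++ t t' = trans (cong Vec.sum (map-++ ∣_∣ t t')) (sum-++ (Vec.map ∣_∣ t))

size-tabulate : ∀ {D k} (f : Fin D → Subset k) {c} → (∀ r → ∣ f r ∣ ≡ c) → size (Vec.tabulate f) ≡ D * c
size-tabulate {zero}  f ∣f∣≡c = refl
size-tabulate {suc D} f ∣f∣≡c = cong₂ _+_ (∣f∣≡c fzero) (size-tabulate (f ∘ fsuc) (∣f∣≡c ∘ fsuc))

∣∁⁅i⁆∣ : ∀ {k} (i : Fin k) → ∣ ∁ ⁅ i ⁆ ∣ ≡ k ∸ 1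
∣∁⁅i⁆∣ i = trans (∣∁p∣≡n∸∣p∣ ⁅ i ⁆) (cong (_ ∸_) (∣⁅x⁆∣≡1 i))

marked∈properTuples : ∀ {D k} (f g : Fin D → Fin k) → 2 ≤ k →
  marked f g ∈ˡ properTuples k (2 * D) (D * k)
marked∈properTuples {D} {suc k'} f g (s≤s 1≤k') =
  subst (λ s → marked f g ∈ˡ properTuples (suc k') (2 * D) s) size-marked (∈-properTuples⁺ proper)
  where
  proper : All Proper (marked f g)
  proper = ++⁺ (tabulate⁺ λ r → subst Proper⁻ (sym (∣∁⁅i⁆∣ (f r))) (1≤k' , ≤-refl))
               (++⁺ (tabulate⁺ λ r → subst Proper⁻ (sym (∣⁅x⁆∣≡1 (g r))) (≤-refl , 1≤k')) [])
    where
    Proper⁻ : ℕ → Set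
    Proper⁻ n = 1 ≤ n × n ≤ k'
  size-marked : size (marked f g) ≡ D * suc k'
  size-marked = begin
    size (marked f g)
      ≡⟨ size-++ (Vec.tabulate (λ r → ∁ ⁅ f r ⁆)) _ ⟩
    size (Vec.tabulate (λ r → ∁ ⁅ f r ⁆)) + size (Vec.tabulate (λ r → ⁅ g r ⁆) Vec.++ [])
      ≡⟨ cong (_ +_) (trans (size-++ (Vec.tabulate (λ r → ⁅ g r ⁆)) []) (+-identityʳ _)) ⟩
    size (Vec.tabulate (λ r → ∁ ⁅ f r ⁆)) + size (Vec.tabulate (λ r → ⁅ g r ⁆))
      ≡⟨ cong₂ _+_ (size-tabulate _ (∣∁⁅i⁆∣ ∘ f)) (size-tabulate _ (∣⁅x⁆∣≡1 ∘ g)) ⟩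
    D * k' + D * 1
      ≡⟨ sym (*-distribˡ-+ D k' 1) ⟩
    D * (k' + 1)
      ≡⟨ cong (D *_) (+-comm k' 1) ⟩
    D * suc k' ∎
    where open ≡-Reasoning

⁅⁆-injective : ∀ {k} {i j : Fin k} → ⁅ i ⁆ ≡ ⁅ j ⁆ → i ≡ j
⁅⁆-injective {i = i} {j} e = x∈⁅y⁆⇒x≡y j (subst (i ∈_) e (x∈⁅x⁆ i))

∁⁅⁆-injective : ∀ {k} {i j : Fin k} → ∁ ⁅ i ⁆ ≡ ∁ ⁅ j ⁆ → i ≡ j
∁⁅⁆-injective {i = i} {j} e with i ≟ j
... | yes i≡j = i≡j
... | no  i≢j = ⊥-elim (x∈p⇒x∉∁p (x∈⁅x⁆ j) (subst (j ∈_) e (x∉p⇒x∈∁p (x≢y⇒x∉⁅y⁆ (i≢j ∘ sym)))))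

-- Orientations joining every ordered pair by a path of length at most 2

module _ {G : Graph} (O : Orientation G) where

  walk₀⇒≡ : ∀ {u v} → Walk O 0 u v → u ≡ v
  walk₀⇒≡ here = refl

  walk₁⇒arc : ∀ {u v} → Walk O 1 u v → Arc O u v
  walk₁⇒arc (step a here) = a

  nonadjacent⇒walk≥2 : ∀ {u v n} → u ≢ v → ¬ Adj G u v → Walk O n u v → 2 ≤ n
  nonadjacent⇒walk≥2 {n = zero}        u≢v _    w = ⊥-elim (u≢v (walk₀⇒≡ w))
  nonadjacent⇒walk≥2 {n = suc zero}    _   ¬adj w = ⊥-elim (¬adj (arc-edge O (walk₁⇒arc w)))
  nonadjacent⇒walk≥2 {n = suc (suc n)} _   _    _ = s≤s (s≤s z≤n)

  arc? : (∀ u v → Dec (Adj G u v)) → ∀ u v → Dec (Arc O u v)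
  arc? adj? u v with adj? u v
  ... | no ¬adj = no (¬adj ∘ arc-edge O)
  ... | yes adj with covers O adj
  ...   | inj₁ uv = yes uv
  ...   | inj₂ vu = no (λ uv → antisym O uv vu)

  WalksWithin2 : Set
  WalksWithin2 = ∀ u v → ∃ λ n → n ≤ 2 × Walk O n u v

  module _ (_≟_ : DecidableEquality (V G)) (adj? : ∀ u v → Dec (Adj G u v)) (within2 : WalksWithin2) where

    distance≤2 : ∀ u v → ∃ λ n → Dist O u v n × n ≤ 2
    distance≤2 u v with u ≟ v
    ... | yes refl = 0 , (here , λ _ ()) , z≤n
    ... | no u≢v with arc? adj? u v
    ...   | yes uv = 1 , (step uv here , λ { zero _ w → u≢v (walk₀⇒≡ w) ; (suc _) (s≤s ()) _ }) , s≤s z≤n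
    ...   | no ¬uv with within2 u v
    ...     | zero           , _ , w = ⊥-elim (u≢v (walk₀⇒≡ w))
    ...     | suc zero       , _ , w = ⊥-elim (¬uv (walk₁⇒arc w))
    ...     | suc (suc zero) , _ , w = 2 , (w , shorter) , ≤-refl
      where
      shorter : ∀ m → m < 2 → ¬ Walk O m u v
      shorter zero           _ w₀ = u≢v (walk₀⇒≡ w₀)
      shorter (suc zero)     _ w₁ = ¬uv (walk₁⇒arc w₁)
      shorter (suc (suc _))  (s≤s (s≤s ()))
    ...     | suc (suc (suc _)) , s≤s (s≤s ()) , _

    strong : Strong O
    strong u v with within2 u v
    ... | n , _ , w = n , w

    diameter≡2 : ∀ {u v} → u ≢ v → ¬ Adj G u v → HasDiameter O 2
    diameter≡2 {u} {v} u≢v ¬adj = distance≤2 , u , v , exactly2 (distance≤2 u v)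
      where
      exactly2 : (∃ λ n → Dist O u v n × n ≤ 2) → Dist O u v 2
      exactly2 (n , dist@(w , _) , n≤2) with ≤-antisym n≤2 (nonadjacent⇒walk≥2 u≢v ¬adj w)
      ... | refl = dist

orientationNumber≡2 : ∀ {G : Graph} → DecidableEquality (V G) → (∀ u v → Dec (Adj G u v)) →
  ∀ {u v} → u ≢ v → ¬ Adj G u v → (O : Orientation G) → WalksWithin2 O → OrientationNumber G 2
orientationNumber≡2 _≟_ adj? {u} {v} u≢v ¬adj O within2 =
  (O , strong O _≟_ adj? within2 , diameter≡2 O _≟_ adj? within2 u≢v ¬adj) ,
  λ { O' _ m (bounded , _) → let (n , (w , _) , n≤m) = bounded u v
                             in ≤-trans (nonadjacent⇒walk≥2 O' u≢v ¬adj w) n≤m }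

-- Orientations of K(p, p, q) from blocks and out-neighbourhoods

pattern A a = inj₁ a
pattern B b = inj₂ (inj₁ b)
pattern C c = inj₂ (inj₂ c)

KV-≟ : ∀ {p q} → DecidableEquality (KV p q)
KV-≟ = Sum.≡-dec _≟_ (Sum.≡-dec _≟_ _≟_)

K-adj? : ∀ {p q} (u v : KV p q) → Dec (Adj (K p q) u v)
K-adj? u v = ¬? (part u ≟ part v)

module TwoStepOrientation {p q D : ℕ} (block : Fin p → Fin D) (outA outB : Fin q → Subset p) where

  data _⇒_ : KV p q → KV p q → Set where
    A⇒B : ∀ {a b} → block a ≢ block b → A a ⇒ B b
    B⇒A : ∀ {b a} → block b ≡ block a → B b ⇒ A a
    C⇒A : ∀ {c a} → a ∈ outA c → C c ⇒ A a
    A⇒C : ∀ {a c} → a ∉ outA c → A a ⇒ C c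
    C⇒B : ∀ {c b} → b ∈ outB c → C c ⇒ B b
    B⇒C : ∀ {b c} → b ∉ outB c → B b ⇒ C c

  ⇒-edge : ∀ {u v} → u ⇒ v → Adj (K p q) u v
  ⇒-edge (A⇒B _) ()
  ⇒-edge (B⇒A _) ()
  ⇒-edge (C⇒A _) ()
  ⇒-edge (A⇒C _) ()
  ⇒-edge (C⇒B _) ()
  ⇒-edge (B⇒C _) ()

  ⇒-antisym : ∀ {u v} → u ⇒ v → v ⇒ u → ⊥
  ⇒-antisym (A⇒B ≢) (B⇒A ≡) = ≢ (sym ≡)
  ⇒-antisym (B⇒A ≡) (A⇒B ≢) = ≢ (sym ≡)
  ⇒-antisym (C⇒A ∈) (A⇒C ∉) = ∉ ∈
  ⇒-antisym (A⇒C ∉) (C⇒A ∈) = ∉ ∈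
  ⇒-antisym (C⇒B ∈) (B⇒C ∉) = ∉ ∈
  ⇒-antisym (B⇒C ∉) (C⇒B ∈) = ∉ ∈

  ⇒-covers : ∀ {u v} → Adj (K p q) u v → u ⇒ v ⊎ v ⇒ u
  ⇒-covers {A a} {A _} adj = ⊥-elim (adj refl)
  ⇒-covers {B b} {B _} adj = ⊥-elim (adj refl)
  ⇒-covers {C c} {C _} adj = ⊥-elim (adj refl)
  ⇒-covers {A a} {B b} _ with block b ≟ block a
  ... | yes ≡ = inj₂ (B⇒A ≡)
  ... | no  ≢ = inj₁ (A⇒B (≢ ∘ sym))
  ⇒-covers {B b} {A a} _ with block b ≟ block a
  ... | yes ≡ = inj₁ (B⇒A ≡)
  ... | no  ≢ = inj₂ (A⇒B (≢ ∘ sym))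
  ⇒-covers {A a} {C c} _ with a ∈? outA c
  ... | yes ∈ = inj₂ (C⇒A ∈)
  ... | no  ∉ = inj₁ (A⇒C ∉)
  ⇒-covers {C c} {A a} _ with a ∈? outA c
  ... | yes ∈ = inj₁ (C⇒A ∈)
  ... | no  ∉ = inj₂ (A⇒C ∉)
  ⇒-covers {B b} {C c} _ with b ∈? outB c
  ... | yes ∈ = inj₂ (C⇒B ∈)
  ... | no  ∉ = inj₁ (B⇒C ∉)
  ⇒-covers {C c} {B b} _ with b ∈? outB c
  ... | yes ∈ = inj₁ (C⇒B ∈)
  ... | no  ∉ = inj₂ (B⇒C ∉)

  orientation : Orientation (K p q)
  orientation = record { Arc = _⇒_ ; arc-edge = ⇒-edge ; covers = ⇒-covers ; antisym = ⇒-antisym }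

  -- Each field supplies the middle vertex of a directed 2-path for the ordered pairs
  -- of one kind that are not joined by an arc.
  record TwoStepConditions : Set where
    field
      A↝A : ∀ {a a'} → a ≢ a' → block a ≡ block a' → ∃ λ c → a ∉ outA c × a' ∈ outA c
      B↝B : ∀ {b b'} → b ≢ b' → block b ≡ block b' → ∃ λ c → b ∉ outB c × b' ∈ outB c
      A↝B : ∀ {a b} → block a ≡ block b → ∃ λ c → a ∉ outA c × b ∈ outB c
      B↝A : ∀ {b a} → block b ≢ block a → ∃ λ c → b ∉ outB c × a ∈ outA c
      A↝C : ∀ {a c} → a ∈ outA c → ∃ λ b → block a ≢ block b × b ∉ outB c
      C↝A : ∀ {c a} → a ∉ outA c → ∃ λ b → b ∈ outB c × block b ≡ block a
      B↝C : ∀ {b c} → b ∈ outB c → ∃ λ a → block b ≡ block a × a ∉ outA c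
      C↝B : ∀ {c b} → b ∉ outB c → ∃ λ a → a ∈ outA c × block a ≢ block b
      C↝C : ∀ {c c'} → c ≢ c' →
            (∃ λ a → a ∈ outA c × a ∉ outA c') ⊎ (∃ λ b → b ∈ outB c × b ∉ outB c')

  within2 : TwoStepConditions → WalksWithin2 orientation
  within2 conditions = go
    where
    open TwoStepConditions conditions

    stay : ∀ {u} → ∃ λ n → n ≤ 2 × Walk orientation n u u
    stay = 0 , z≤n , here

    arc : ∀ {u v} → u ⇒ v → ∃ λ n → n ≤ 2 × Walk orientation n u v
    arc uv = 1 , s≤s z≤n , step uv here

    path : ∀ {u w v} → u ⇒ w → w ⇒ v → ∃ λ n → n ≤ 2 × Walk orientation n u v
    path uw wv = 2 , ≤-refl , step uw (step wv here)

    go : WalksWithin2 orientation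
    go (A a) (A a') with a ≟ a'
    ... | yes refl = stay
    ... | no a≢a' with block a ≟ block a'
    ...   | no  ≢ = path (A⇒B ≢) (B⇒A refl)
    ...   | yes ≡ = let c , a∉ , a'∈ = A↝A a≢a' ≡ in path (A⇒C a∉) (C⇒A a'∈)
    go (B b) (B b') with b ≟ b'
    ... | yes refl = stay
    ... | no b≢b' with block b ≟ block b'
    ...   | no  ≢ = path (B⇒A refl) (A⇒B ≢)
    ...   | yes ≡ = let c , b∉ , b'∈ = B↝B b≢b' ≡ in path (B⇒C b∉) (C⇒B b'∈)
    go (A a) (B b) with block a ≟ block b
    ... | no  ≢ = arc (A⇒B ≢)
    ... | yes ≡ = let c , a∉ , b∈ = A↝B ≡ in path (A⇒C a∉) (C⇒B b∈)
    go (B b) (A a) with block b ≟ block a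
    ... | yes ≡ = arc (B⇒A ≡)
    ... | no  ≢ = let c , b∉ , a∈ = B↝A ≢ in path (B⇒C b∉) (C⇒A a∈)
    go (A a) (C c) with a ∈? outA c
    ... | no  a∉ = arc (A⇒C a∉)
    ... | yes a∈ = let b , ≢ , b∉ = A↝C a∈ in path (A⇒B ≢) (B⇒C b∉)
    go (C c) (A a) with a ∈? outA c
    ... | yes a∈ = arc (C⇒A a∈)
    ... | no  a∉ = let b , b∈ , ≡ = C↝A a∉ in path (C⇒B b∈) (B⇒A ≡)
    go (B b) (C c) with b ∈? outB c
    ... | no  b∉ = arc (B⇒C b∉)
    ... | yes b∈ = let a , ≡ , a∉ = B↝C b∈ in path (B⇒A ≡) (A⇒C a∉)
    go (C c) (B b) with b ∈? outB c
    ... | yes b∈ = arc (C⇒B b∈)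
    ... | no  b∉ = let a , a∈ , ≢ = C↝B b∉ in path (C⇒A a∈) (A⇒B ≢)
    go (C c) (C c') with c ≟ c'
    ... | yes refl = stay
    ... | no c≢c' with C↝C c≢c'
    ...   | inj₁ (a , a∈ , a∉) = path (C⇒A a∈) (A⇒C a∉)
    ...   | inj₂ (b , b∈ , b∉) = path (C⇒B b∈) (B⇒C b∉)

module Blocks (D k : ℕ) where

  block : Fin (D * k) → Fin D
  block = quotient k

  position : Fin (D * k) → Fin k
  position = remainder {D} k

  block-combine : ∀ r i → block (combine r i) ≡ r
  block-combine r i = cong proj₁ (remQuot-combine {D} {k} r i)

  position-combine : ∀ r i → position (combine r i) ≡ i
  position-combine r i = cong proj₂ (remQuot-combine {D} {k} r i)

  block-position-injective : ∀ {a a'} → block a ≡ block a' → position a ≡ position a' → a ≡ a'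
  block-position-injective {a} {a'} b≡ p≡ =
    trans (sym (combine-remQuot {D} k a)) (trans (cong₂ combine b≡ p≡) (combine-remQuot {D} k a'))

  expand : (Fin D → Subset k) → Subset (D * k)
  expand R = Vec.tabulate λ a → Vec.lookup (R (block a)) (position a)

  ∈-expand⁻ : ∀ {R a} → a ∈ expand R → position a ∈ R (block a)
  ∈-expand⁻ {R} {a} a∈ = lookup⇒[]= _ _ (trans (sym (lookup∘tabulate _ a)) ([]=⇒lookup a∈))

  ∈-expand⁺ : ∀ {R a} → position a ∈ R (block a) → a ∈ expand R
  ∈-expand⁺ {R} {a} i∈ = lookup⇒[]= a _ (trans (lookup∘tabulate _ a) ([]=⇒lookup i∈))

  combine∈expand : ∀ {R r i} → i ∈ R r → combine r i ∈ expand R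
  combine∈expand {R} {r} {i} i∈ =
    ∈-expand⁺ {R} (subst₂ (λ r i → i ∈ R r) (sym (block-combine r i)) (sym (position-combine r i)) i∈)

  combine∉expand : ∀ {R r i} → i ∉ R r → combine r i ∉ expand R
  combine∉expand {R} {r} {i} i∉ c∈ =
    i∉ (subst₂ (λ r i → i ∈ R r) (block-combine r i) (position-combine r i) (∈-expand⁻ {R} c∈))

  meets : ∀ {R} r → Nonempty (R r) → ∃ λ a → a ∈ expand R × block a ≡ r
  meets {R} r (i , i∈) = combine r i , combine∈expand {R} i∈ , block-combine r i

  misses : ∀ {R} r → Nonempty (∁ (R r)) → ∃ λ a → a ∉ expand R × block a ≡ r
  misses {R} r (i , i∈∁) = combine r i , combine∉expand {R} (x∈∁p⇒x∉p i∈∁) , block-combine r i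

record BlockPatterns (D k q' : ℕ) : Set where
  field
    rowsA rowsB : Fin q' → Fin D → Subset k
    properA     : ∀ z r → Nonempty (rowsA z r) × Nonempty (∁ (rowsA z r))
    properB     : ∀ z r → Nonempty (rowsB z r) × Nonempty (∁ (rowsB z r))
    separated   : ∀ {z z'} → z ≢ z' → ∃₂ λ r i →
                  (i ∈ rowsA z r × i ∉ rowsA z' r) ⊎ (i ∈ rowsB z r × i ∉ rowsB z' r)
    pinned      : ∀ i → ∃ λ z → (∀ r → rowsA z r ≡ ∁ ⁅ i ⁆) × (∀ r → rowsB z r ≡ ⁅ i ⁆)

pattern c₀   = fzero
pattern c₁   = fsuc fzero
pattern c⁺ z = fsuc (fsuc z)

module PatternOrientation {D' k' q' : ℕ} (patterns : BlockPatterns (2 + D') (suc k') q') where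

  open BlockPatterns patterns
  open Blocks (2 + D') (suc k')

  other : Fin (2 + D') → Fin (2 + D')
  other fzero    = fsuc fzero
  other (fsuc _) = fzero

  other≢ : ∀ r → other r ≢ r
  other≢ fzero    ()
  other≢ (fsuc _) ()

  outA outB : Fin (2 + q') → Subset ((2 + D') * suc k')
  outA c₀     = ∅
  outA c₁     = full
  outA (c⁺ z) = expand (rowsA z)
  outB c₀     = full
  outB c₁     = ∅
  outB (c⁺ z) = expand (rowsB z)

  open TwoStepOrientation block outA outB

  pointIn : Fin (2 + D') → Fin ((2 + D') * suc k')
  pointIn r = combine r fzero

  A↝A : ∀ {a a'} → a ≢ a' → block a ≡ block a' → ∃ λ c → a ∉ outA c × a' ∈ outA c
  A↝A {a} {a'} a≢a' b≡ with pinned (position a)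
  ... | z , rowsA≡ , _ = c⁺ z , a∉ , a'∈
    where
    a∉ : a ∉ expand (rowsA z)
    a∉ a∈ = x∈p⇒x∉∁p (x∈⁅x⁆ (position a))
              (subst (position a ∈_) (rowsA≡ (block a)) (∈-expand⁻ {rowsA z} a∈))
    a'∈ : a' ∈ expand (rowsA z)
    a'∈ = ∈-expand⁺ {rowsA z} (subst (position a' ∈_) (sym (rowsA≡ (block a')))
            (x∉p⇒x∈∁p (x≢y⇒x∉⁅y⁆ λ p≡ → a≢a' (block-position-injective b≡ (sym p≡)))))

  B↝B : ∀ {b b'} → b ≢ b' → block b ≡ block b' → ∃ λ c → b ∉ outB c × b' ∈ outB c
  B↝B {b} {b'} b≢b' b≡ with pinned (position b')
  ... | z , _ , rowsB≡ = c⁺ z , b∉ , b'∈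
    where
    b∉ : b ∉ expand (rowsB z)
    b∉ b∈ = x≢y⇒x∉⁅y⁆ (λ p≡ → b≢b' (block-position-injective b≡ p≡))
              (subst (position b ∈_) (rowsB≡ (block b)) (∈-expand⁻ {rowsB z} b∈))
    b'∈ : b' ∈ expand (rowsB z)
    b'∈ = ∈-expand⁺ {rowsB z} (subst (position b' ∈_) (sym (rowsB≡ (block b'))) (x∈⁅x⁆ (position b')))

  A↝C : ∀ {a c} → a ∈ outA c → ∃ λ b → block a ≢ block b × b ∉ outB c
  A↝C {c = c₀}   a∈ = ⊥-elim (∉⊥ a∈)
  A↝C {a} {c₁}   _  = pointIn (other (block a)) ,
                      (λ b≡ → other≢ (block a) (sym (trans b≡ (block-combine _ _)))) , ∉⊥
  A↝C {a} {c⁺ z} _  with misses {rowsB z} (other (block a)) (proj₂ (properB z _))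
  ... | b , b∉ , b≡ = b , (λ a≡ → other≢ (block a) (sym (trans a≡ b≡))) , b∉

  C↝A : ∀ {c a} → a ∉ outA c → ∃ λ b → b ∈ outB c × block b ≡ block a
  C↝A {c₀}   {a} _  = a , ∈⊤ , refl
  C↝A {c₁}       a∉ = ⊥-elim (a∉ ∈⊤)
  C↝A {c⁺ z} {a} _  = meets {rowsB z} (block a) (proj₁ (properB z _))

  B↝C : ∀ {b c} → b ∈ outB c → ∃ λ a → block b ≡ block a × a ∉ outA c
  B↝C {b} {c₀}   _  = b , refl , ∉⊥
  B↝C {c = c₁}   b∈ = ⊥-elim (∉⊥ b∈)
  B↝C {b} {c⁺ z} _  with misses {rowsA z} (block b) (proj₂ (properA z _))
  ... | a , a∉ , a≡ = a , sym a≡ , a∉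

  C↝B : ∀ {c b} → b ∉ outB c → ∃ λ a → a ∈ outA c × block a ≢ block b
  C↝B {c₀}       b∉ = ⊥-elim (b∉ ∈⊤)
  C↝B {c₁}   {b} _  = pointIn (other (block b)) , ∈⊤ ,
                      λ a≡ → other≢ (block b) (trans (sym (block-combine _ _)) a≡)
  C↝B {c⁺ z} {b} _  with meets {rowsA z} (other (block b)) (proj₁ (properA z _))
  ... | a , a∈ , a≡ = a , a∈ , λ a≡' → other≢ (block b) (trans (sym a≡) a≡')

  C↝C : ∀ {c c'} → c ≢ c' → (∃ λ a → a ∈ outA c × a ∉ outA c') ⊎ (∃ λ b → b ∈ outB c × b ∉ outB c')
  C↝C {c₀}   {c₀}    c≢c' = ⊥-elim (c≢c' refl)
  C↝C {c₁}   {c₁}    c≢c' = ⊥-elim (c≢c' refl)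
  C↝C {c₀}   {c₁}    _    = inj₂ (pointIn fzero , ∈⊤ , ∉⊥)
  C↝C {c₁}   {c₀}    _    = inj₁ (pointIn fzero , ∈⊤ , ∉⊥)
  C↝C {c₀}   {c⁺ z'} _    =
    let b , b∉ , _ = misses {rowsB z'} fzero (proj₂ (properB z' _)) in inj₂ (b , ∈⊤ , b∉)
  C↝C {c₁}   {c⁺ z'} _    =
    let a , a∉ , _ = misses {rowsA z'} fzero (proj₂ (properA z' _)) in inj₁ (a , ∈⊤ , a∉)
  C↝C {c⁺ z} {c₀}    _    =
    let a , a∈ , _ = meets {rowsA z} fzero (proj₁ (properA z _)) in inj₁ (a , a∈ , ∉⊥)
  C↝C {c⁺ z} {c₁}    _    =
    let b , b∈ , _ = meets {rowsB z} fzero (proj₁ (properB z _)) in inj₂ (b , b∈ , ∉⊥)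
  C↝C {c⁺ z} {c⁺ z'} c≢c' with separated (c≢c' ∘ cong (fsuc ∘ fsuc))
  ... | r , i , inj₁ (i∈ , i∉) =
    inj₁ (combine r i , combine∈expand {rowsA z} i∈ , combine∉expand {rowsA z'} i∉)
  ... | r , i , inj₂ (i∈ , i∉) =
    inj₂ (combine r i , combine∈expand {rowsB z} i∈ , combine∉expand {rowsB z'} i∉)

  conditions : TwoStepConditions
  conditions = record
    { A↝A = A↝A ; B↝B = B↝B ; A↝B = λ _ → c₀ , ∉⊥ , ∈⊤ ; B↝A = λ _ → c₁ , ∉⊥ , ∈⊤
    ; A↝C = λ {a c} → A↝C {a} {c} ; C↝A = λ {c a} → C↝A {c} {a}
    ; B↝C = λ {b c} → B↝C {b} {c} ; C↝B = λ {c b} → C↝B {c} {b}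
    ; C↝C = λ {c c'} → C↝C {c} {c'} }

  orientationWithin2 : Σ (Orientation (K ((2 + D') * suc k') (2 + q'))) WalksWithin2
  orientationWithin2 = orientation , within2 conditions

-- Patterns from tuples of subsets

module _ {D₀ k₀ : ℕ} where

  private
    D = suc D₀
    k = 2 + k₀
    2≤k : 2 ≤ k
    2≤k = s≤s (s≤s z≤n)

  pinnedTuple : Fin k → Vec (Subset k) (2 * D)
  pinnedTuple i = marked {D} (λ _ → i) (λ _ → i)

  pinnedTuple-injective : Injective _≡_ _≡_ pinnedTuple
  pinnedTuple-injective {i} {j} e =
    ⁅⁆-injective (trans (sym (rowB-marked {D} (λ _ → i) (λ _ → i) fzero))
                       (trans (cong (λ t → rowB t fzero) e) (rowB-marked {D} (λ _ → j) (λ _ → j) fzero)))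

  blockPatterns : ∀ {q'} → k ≤ q' → q' ≤ F k (2 * D) (D * k) → BlockPatterns D k q'
  blockPatterns {q'} k≤q' q'≤F
    with injectiveFamilyExtending (properTuples-unique k (2 * D) (D * k)) k≤q'
           (subst (q' ≤_) (sym (length-properTuples k (2 * D) (D * k))) q'≤F)
           pinnedTuple pinnedTuple-injective (λ i → marked∈properTuples {D} (λ _ → i) (λ _ → i) 2≤k)
  ... | tuple , tuple-injective , tuple∈ , tuple-covers = record
    { rowsA = rowA ∘ tuple ; rowsB = rowB ∘ tuple
    ; properA = λ z r → proper z (r ↑ˡ (D + 0)) ; properB = λ z r → proper z (D ↑ʳ (r ↑ˡ 0))
    ; separated = separated ; pinned = pinned }
    where
    proper : ∀ z j → Nonempty (Vec.lookup (tuple z) j) × Nonempty (∁ (Vec.lookup (tuple z) j))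
    proper z j = let p = lookup⁺ (proj₁ (∈-properTuples⁻ k (2 * D) (D * k) (tuple∈ z))) j
                 in Proper⇒Nonempty p , Proper⇒Nonempty∁ p

    separated : ∀ {z z'} → z ≢ z' → ∃₂ λ r i →
      (i ∈ rowA (tuple z) r × i ∉ rowA (tuple z') r) ⊎ (i ∈ rowB (tuple z) r × i ∉ rowB (tuple z') r)
    separated {z} {z'} z≢z'
      with separatingRow {t = tuple z} {tuple z'} (≤-reflexive sizes≡) (z≢z' ∘ tuple-injective)
      where
      sizes≡ : size (tuple z') ≡ size (tuple z)
      sizes≡ = trans (proj₂ (∈-properTuples⁻ k _ _ (tuple∈ z')))
                     (sym (proj₂ (∈-properTuples⁻ k _ _ (tuple∈ z))))
    ... | j , i , sep with rowIndex-cases D j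
    ...   | inj₁ (r , refl) = r , i , inj₁ sep
    ...   | inj₂ (r , refl) = r , i , inj₂ sep

    pinned : ∀ i → ∃ λ z → (∀ r → rowA (tuple z) r ≡ ∁ ⁅ i ⁆) × (∀ r → rowB (tuple z) r ≡ ⁅ i ⁆)
    pinned i with tuple-covers i
    ... | z , tz≡ = z , (λ r → trans (cong (λ t → rowA t r) tz≡) (rowA-marked {D} (λ _ → i) (λ _ → i) r))
                      , (λ r → trans (cong (λ t → rowB t r) tz≡) (rowB-marked {D} (λ _ → i) (λ _ → i) r))

  -- Distinct points of Fin (D * k) give distinct proper tuples: the B-rows record
  -- the position of the point, and a different mark in one A-row records its block.
  D*k≤F : D * k ≤ F k (2 * D) (D * k)
  D*k≤F = subst (D * k ≤_) (length-properTuples k (2 * D) (D * k))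
            (injection-into-list⇒≤ encode encode-injective
              (λ a → marked∈properTuples (mark (block a)) (λ _ → position a) 2≤k))
    where
    open Blocks D k

    mark : Fin D → Fin D → Fin k
    mark r r' = if does (r' ≟ r) then fsuc fzero else fzero

    mark-self : ∀ r → mark r r ≡ fsuc fzero
    mark-self r with r ≟ r
    ... | yes _  = refl
    ... | no r≢r = ⊥-elim (r≢r refl)

    mark≡1⇒≡ : ∀ {r r'} → fsuc fzero ≡ mark r' r → r ≡ r'
    mark≡1⇒≡ {r} {r'} e with r ≟ r'
    ... | yes r≡r' = r≡r'
    mark≡1⇒≡ () | no _

    encode : Fin (D * k) → Vec (Subset k) (2 * D)
    encode a = marked (mark (block a)) (λ _ → position a)

    encode-injective : Injective _≡_ _≡_ encode
    encode-injective {a} {a'} e = block-position-injective block≡ position≡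
      where
      rowsA≡ : ∁ ⁅ mark (block a) (block a) ⁆ ≡ ∁ ⁅ mark (block a') (block a) ⁆
      rowsA≡ = trans (sym (rowA-marked (mark (block a)) (λ _ → position a) (block a)))
                     (trans (cong (λ t → rowA t (block a)) e)
                            (rowA-marked (mark (block a')) (λ _ → position a') (block a)))
      block≡ : block a ≡ block a'
      block≡ = mark≡1⇒≡ (trans (sym (mark-self (block a))) (∁⁅⁆-injective rowsA≡))
      position≡ : position a ≡ position a'
      position≡ = ⁅⁆-injective (trans (sym (rowB-marked (mark (block a)) (λ _ → position a) (block a)))
                    (trans (cong (λ t → rowB t (block a)) e)
                           (rowB-marked (mark (block a')) (λ _ → position a') (block a))))

-- Choosing the factorisation

≤-foldr-⊔ : ∀ {A : Set} (f : A → ℕ) xs {n} → 1 ≤ n → n ≤ foldr _⊔_ 0 (map f xs) →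
  ∃ λ x → x ∈ˡ xs × n ≤ f x
≤-foldr-⊔ f []       1≤n n≤0 = ⊥-elim (1+n≰n (≤-trans 1≤n n≤0))
≤-foldr-⊔ f (x ∷ xs) 1≤n n≤  with ⊔-sel (f x) (foldr _⊔_ 0 (map f xs))
... | inj₁ max≡fx = x , here refl , subst (_ ≤_) max≡fx n≤
... | inj₂ max≡ with ≤-foldr-⊔ f xs 1≤n (subst (_ ≤_) max≡ n≤)
...   | y , y∈ , n≤fy = y , there y∈ , n≤fy

record Admissible (p q' : ℕ) : Set where
  field
    D k   : ℕ
    2≤D   : 2 ≤ D
    2≤k   : 2 ≤ k
    p≡D*k : p ≡ D * k
    k≤q'  : k ≤ q'
    q'≤F  : q' ≤ F k (2 * D) p

Admissible⇒orientationWithin2 : ∀ {p q'} → Admissible p q' → Σ (Orientation (K p (2 + q'))) WalksWithin2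
Admissible⇒orientationWithin2
  record { D = suc (suc D') ; k = suc (suc k') ; 2≤D = s≤s (s≤s _) ; 2≤k = s≤s (s≤s _)
         ; p≡D*k = refl ; k≤q' = k≤q' ; q'≤F = q'≤F } =
  PatternOrientation.orientationWithin2 (blockPatterns {suc D'} {k'} k≤q' q'≤F)

factorisation : ∀ {p q'} D k → 2 ≤ D → D < p → D * k ≡ p → p < q' → q' ≤ F k (2 * D) p →
  Admissible p q'
factorisation {p} D zero          _   D<p D*0≡p _   _    =
  ⊥-elim (<⇒≢ (≤-<-trans z≤n D<p) (trans (sym (*-zeroʳ D)) D*0≡p))
factorisation {p} D (suc zero)    _   D<p D*1≡p _   _    =
  ⊥-elim (<⇒≢ D<p (trans (sym (*-identityʳ D)) D*1≡p))
factorisation {p} D k@(suc (suc _)) 2≤D@(s≤s (s≤s _)) _ D*k≡p p<q' q'≤F = record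
  { D = D ; k = k ; 2≤D = 2≤D ; 2≤k = s≤s (s≤s z≤n) ; p≡D*k = sym D*k≡p
  ; k≤q' = ≤-trans (≤-trans (m≤n*m k D) (≤-reflexive D*k≡p)) (<⇒≤ p<q') ; q'≤F = q'≤F }

≤-if-does : ∀ {P : Set} (P? : Dec P) {n m} → 1 ≤ n → n ≤ (if does P? then m else 0) → P × n ≤ m
≤-if-does (yes p) _   n≤m = p , n≤m
≤-if-does (no  _) 1≤n n≤0 = ⊥-elim (1+n≰n (≤-trans 1≤n n≤0))

admissibleViaMaximum : ∀ {p q'} → 2 ≤ p → p < q' → q' ≤ maxPhiStar p → Admissible p q'
admissibleViaMaximum {p} {q'} 2≤p p<q' q'≤max
  with ≤-foldr-⊔ divisorTerm (upTo (p ∸ 2)) 1≤q' q'≤max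
  where
  1≤q' : 1 ≤ q'
  1≤q' = ≤-<-trans z≤n p<q'
  divisorTerm : ℕ → ℕ
  divisorTerm i = if does ((2 + i) ∣? p) then PhiStar p (2 + i) else 0
... | i , i∈ , q'≤term with ≤-if-does ((2 + i) ∣? p) (≤-<-trans z≤n p<q') q'≤term
...   | d∣p , q'≤Φ* =
  factorisation (2 + i) (p / (2 + i)) (s≤s (s≤s z≤n)) 2+i<p (m*[n/m]≡n d∣p) p<q' q'≤Φ*
  where
  2+i<p : 2 + i < p
  2+i<p = subst (_≤ p) (+-comm (suc i) 2) (m≤o∸n⇒m+n≤o (suc i) 2≤p (∈-upTo⁻ i∈))

p≤F : ∀ {p k d} → 2 ≤ k → 2 ≤ d → p ≡ d * k → p ≤ F k (2 * d) p
p≤F {k = suc (suc k₀)} {suc D₀} (s≤s (s≤s _)) (s≤s _) refl = D*k≤F {D₀} {k₀}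

admissible : ∀ {p k d q'} → 2 ≤ p → p ≡ k * d → 2 ≤ k → 2 ≤ d → 2 * k ≤ q' → q' ≤ maxPhiStar p →
  Admissible p q'
admissible {p} {k} {d} {q'} 2≤p p≡k*d 2≤k 2≤d 2k≤q' q'≤max with q' ≤? F k (2 * d) p
... | yes q'≤F = record
  { D = d ; k = k ; 2≤D = 2≤d ; 2≤k = 2≤k ; p≡D*k = p≡d*k
  ; k≤q' = ≤-trans (m≤m+n k (k + 0)) 2k≤q' ; q'≤F = q'≤F }
  where
  p≡d*k : p ≡ d * k
  p≡d*k = trans p≡k*d (*-comm k d)
... | no q'≰F =
  admissibleViaMaximum 2≤p (≤-<-trans (p≤F 2≤k 2≤d (trans p≡k*d (*-comm k d))) (≰⇒> q'≰F)) q'≤max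

nonadjacentPair : ∀ {p q} → 2 ≤ p → Σ (KV p q) λ u → Σ (KV p q) λ v → u ≢ v × ¬ Adj (K p q) u v
nonadjacentPair (s≤s (s≤s _)) = A fzero , A (fsuc fzero) , (λ ()) , λ same-part → same-part refl

proposition3p7 : (p k d q : ℕ) → 4 ≤ p → p ≡ k * d → 1 < k → k < p → 1 < d → d < p → 2 * k + 2 ≤ q → q ≤ maxPhiStar p + 2 → OrientationNumber (Kppq p q) 2
proposition3p7 p k d q 4≤p p≡k*d 1<k _ 1<d _ 2k+2≤q q≤max+2
  with Admissible⇒orientationWithin2 (admissible 2≤p p≡k*d 1<k 1<d 2k≤q∸2 q∸2≤max)
     | nonadjacentPair {q = 2 + (q ∸ 2)} 2≤p
  where
  2≤p : 2 ≤ p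
  2≤p = ≤-trans (s≤s (s≤s z≤n)) 4≤p
  2k≤q∸2 : 2 * k ≤ q ∸ 2
  2k≤q∸2 = m+n≤o⇒m≤o∸n (2 * k) 2k+2≤q
  q∸2≤max : q ∸ 2 ≤ maxPhiStar p
  q∸2≤max = m≤n+o⇒m∸n≤o q 2 (subst (q ≤_) (+-comm (maxPhiStar p) 2) q≤max+2)
... | O , within2 | _ , _ , u≢v , ¬adj =
  subst (λ q → OrientationNumber (Kppq p q) 2) (m+[n∸m]≡n (≤-trans (m≤n+m 2 (2 * k)) 2k+2≤q))
        (orientationNumber≡2 KV-≟ K-adj? u≢v ¬adj O within2)
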